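{- Let ${\cal P}=\{P_1,\dots,P_l\}$ be a collection of multipartite partial orders on a finite set $D$, and let $G_{\cal P}$ be the digraph on vertex set $D$ with an arc $(a,b)$ whenever $a\ne b$ and $a$ precedes $b$ in some $P_i$. If $G_{\cal P}$ contains a directed cycle, then $G_{\cal P}$ contains arcs $(a,b)$ and $(b,a)$ for some distinct $a,b\in D$.
   Context: A partial order $\preceq$ on $D$ is multipartite if there is a partition $D=D_1\cup\dots\cup D_t$ with $t\ge2$ (nonempty classes) such that $d\preceq d'$ holds iff $d=d'$ or $d\in D_i$ and $d'\in D_j$ for some $1\le i<j\le t$. -}

module Defs where

open import Level using (0ℓ)
open import Data.Nat using (ℕ; suc; _≥_)
open import Data.Fin using (Fin; _<_; zero; suc)
import Data.Nat
import Data.Nat.DivMod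
import Data.Fin
open import Data.Product using (Σ; ∃; ∃-syntax; _×_; _,_)
open import Data.Sum using (_⊎_)
open import Function using (Injective; Surjective)
open import Relation.Binary.Core using (Rel)
open import Relation.Binary.Definitions using ()
open import Relation.Binary.Structures using (IsPartialOrder)
open import Relation.Binary.PropositionalEquality using (_≡_; _≢_)
open import Relation.Nullary using (¬_)

-- A partial order on D is multipartite if there is a partition of D into
-- t ≥ 2 nonempty classes D_1,…,D_t (encoded by a surjective class map
-- c : D → Fin t) such that d ≼ d' iff d = d' or class(d) < class(d').
IsMultipartite : {D : Set} → Rel D 0ℓ → Set
IsMultipartite {D} _≼_ =
  IsPartialOrder _≡_ _≼_ ×
  Σ ℕ λ t → (t ≥ 2) × Σ (D → Fin t) λ c →
    Surjective _≡_ _≡_ c ×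
    (∀ d d' → (d ≼ d' → (d ≡ d' ⊎ c d < c d')) × ((d ≡ d' ⊎ c d < c d') → d ≼ d'))

Arc : {D : Set} {l : ℕ} → (Fin l → Rel D 0ℓ) → D → D → Set
Arc P a b = (a ≢ b) × ∃[ i ] P i a b

next : {k : ℕ} → Fin (suc k) → Fin (suc k)
next {k} j = Data.Fin.fromℕ< {Data.Nat._%_ (suc (Data.Fin.toℕ j)) (suc k)} (Data.Nat.DivMod.m%n<n (suc (Data.Fin.toℕ j)) (suc k))

HasDirectedCycle : {D : Set} → (D → D → Set) → Set
HasDirectedCycle {D} E =
  Σ ℕ λ k → (suc k ≥ 2) × Σ (Fin (suc k) → D) λ v →
    Injective _≡_ _≡_ v × (∀ j → E (v j) (v (next j)))

{-# OPTIONS --safe #-}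
-- Every multipartite order is ranked by its class map, so its strict part ≺ is
-- cotransitive: a ≺ b implies a ≺ c or c ≺ b for every c.  Walk around a
-- directed cycle of G_P starting with an arc a → b from P_i.  If the next arc
-- b → c satisfies a ≺_i c, replace the two arcs by the single arc a → c and
-- continue on the shorter closed walk; otherwise c ≺_i b, and together with the
-- arc b → c this is the required pair of opposite arcs.  The walk cannot shrink
-- to nothing, because G_P has no loops.
module Submission where

open import Defs
open import Level using (0ℓ)
open import Data.Nat using (ℕ; suc; s<s)
open import Data.Nat.DivMod using (_%_; n%n≡0; m<n⇒m%n≡m)
open import Data.Fin using (Fin; zero; suc; _<_; toℕ; fromℕ; inject₁)
open import Data.Fin.Properties
  using (toℕ-injective; toℕ-fromℕ<; toℕ-fromℕ; toℕ-inject₁; toℕ<n; <-cmp; <-trans; <-irrefl)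
open import Data.Fin.Induction using (>-weakInduction)
open import Data.Product using (_×_; ∃-syntax; _,_; proj₁; proj₂)
open import Data.Sum using (_⊎_; inj₁; inj₂)
open import Data.Empty using (⊥-elim)
open import Relation.Binary.Core using (Rel)
open import Relation.Binary.Definitions using (Cotransitive; tri<; tri≈; tri>)
open import Relation.Binary.Construct.Closure.ReflexiveTransitive using (Star; ε; _◅_)
open import Relation.Binary.PropositionalEquality
  using (_≡_; _≢_; refl; cong; subst; module ≡-Reasoning)

Strict : {D : Set} → Rel D 0ℓ → Rel D 0ℓ
Strict _≼_ a b = a ≢ b × a ≼ b

<-cotransitive : ∀ {t} → Cotransitive (_<_ {t})
<-cotransitive {x = x} x<y z with <-cmp x z
... | tri< x<z _ _ = inj₁ x<z
... | tri≈ _ refl _ = inj₂ x<y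
... | tri> _ _ z<x = inj₂ (<-trans z<x x<y)

module RankedOrder {D : Set} {_≼_ : Rel D 0ℓ} {t : ℕ} (rank : D → Fin t)
  (≼⇔ : ∀ d d' → (d ≼ d' → (d ≡ d' ⊎ rank d < rank d')) × ((d ≡ d' ⊎ rank d < rank d') → d ≼ d'))
  where

  strict⇒rank< : ∀ {a b} → Strict _≼_ a b → rank a < rank b
  strict⇒rank< {a} {b} (a≢b , a≼b) with proj₁ (≼⇔ a b) a≼b
  ... | inj₁ a≡b = ⊥-elim (a≢b a≡b)
  ... | inj₂ a<b = a<b

  rank<⇒strict : ∀ {a b} → rank a < rank b → Strict _≼_ a b
  rank<⇒strict {a} {b} a<b = (λ { refl → <-irrefl refl a<b }) , proj₂ (≼⇔ a b) (inj₂ a<b)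

  strict-cotransitive : Cotransitive (Strict _≼_)
  strict-cotransitive a≺b c with <-cotransitive (strict⇒rank< a≺b) (rank c)
  ... | inj₁ a<c = inj₁ (rank<⇒strict a<c)
  ... | inj₂ c<b = inj₂ (rank<⇒strict c<b)

multipartite⇒strict-cotransitive : {D : Set} {_≼_ : Rel D 0ℓ} →
  IsMultipartite _≼_ → Cotransitive (Strict _≼_)
multipartite⇒strict-cotransitive (_ , _ , _ , class , _ , ≼⇔) =
  RankedOrder.strict-cotransitive class ≼⇔

module _ {D : Set} {l : ℕ} (P : Fin l → Rel D 0ℓ)
  (cotransitive : ∀ i → Cotransitive (Strict (P i)))
  where

  closed-walk⇒opposite-arcs : ∀ {a b} → Arc P a b → Star (Arc P) b a →
    ∃[ x ] ∃[ y ] (x ≢ y × Arc P x y × Arc P y x)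
  closed-walk⇒opposite-arcs (a≢a , _) ε = ⊥-elim (a≢a refl)
  closed-walk⇒opposite-arcs {b = b} (a≢b , i , a≼b) (_◅_ {j = c} b→c c⇝a)
    with cotransitive i (a≢b , a≼b) c
  ... | inj₁ (a≢c , a≼c) = closed-walk⇒opposite-arcs (a≢c , i , a≼c) c⇝a
  ... | inj₂ (c≢b , c≼b) = b , c , proj₁ b→c , b→c , (c≢b , i , c≼b)

next-fromℕ : ∀ k → next (fromℕ k) ≡ zero
next-fromℕ k = toℕ-injective (begin
  toℕ (next (fromℕ k))         ≡⟨ toℕ-fromℕ< _ ⟩
  suc (toℕ (fromℕ k)) % suc k  ≡⟨ cong (λ m → suc m % suc k) (toℕ-fromℕ k) ⟩
  suc k % suc k                ≡⟨ n%n≡0 (suc k) ⟩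
  0                            ∎)
  where open ≡-Reasoning

next-inject₁ : ∀ {k} (j : Fin k) → next (inject₁ j) ≡ suc j
next-inject₁ {k} j = toℕ-injective (begin
  toℕ (next (inject₁ j))         ≡⟨ toℕ-fromℕ< _ ⟩
  suc (toℕ (inject₁ j)) % suc k  ≡⟨ cong (λ m → suc m % suc k) (toℕ-inject₁ j) ⟩
  suc (toℕ j) % suc k            ≡⟨ m<n⇒m%n≡m (s<s (toℕ<n j)) ⟩
  suc (toℕ j)                    ∎)
  where open ≡-Reasoning

cycle⇒walk-to-start : {D : Set} {E : Rel D 0ℓ} {k : ℕ} (v : Fin (suc k) → D) →
  (∀ j → E (v j) (v (next j))) → ∀ j → Star E (v j) (v zero)
cycle⇒walk-to-start {E = E} {k} v arcs = >-weakInduction (λ j → Star E (v j) (v zero))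
  (subst (λ j → E (v (fromℕ k)) (v j)) (next-fromℕ k) (arcs (fromℕ k)) ◅ ε)
  (λ j walk → subst (λ j′ → E (v (inject₁ j)) (v j′)) (next-inject₁ j) (arcs (inject₁ j)) ◅ walk)

lemmaA5 : (n l : ℕ) (P : Fin l → Rel (Fin n) 0ℓ) →
    (∀ i → IsMultipartite (P i)) →
    HasDirectedCycle (Arc P) →
    ∃[ a ] ∃[ b ] (a ≢ b × Arc P a b × Arc P b a)
lemmaA5 n l P multipartite (_ , _ , v , _ , arcs) =
  closed-walk⇒opposite-arcs P (λ i → multipartite⇒strict-cotransitive (multipartite i))
    (arcs zero) (cycle⇒walk-to-start v arcs (next zero))
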